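{- For integers $0\le k_1\le k_2\le N$, $$T_1(N,k_1,k_2)=\theta^{2N-k_1-k_2}\,P_{k_1}\,P_{k_2-1}\,(P_{N-2})!.$$
   Context: Let $\theta>0$. $\mathrm{inv}(\pi)$ is the number of pairs $i<j$ with $\pi_i>\pi_j$. $P_n=1+\theta+\cdots+\theta^{n-1}$ ($P_0=0$), $(P_n)!=P_n\cdots P_1$, $(P_0)!=1$. For $\pi\in S_n$, position $i$ is a left-to-right maximum if $\pi_i>\pi_j$ for all $j<i$, and a left-to-right second maximum if exactly one $j<i$ has $\pi_j>\pi_i$. The $(k_1,k_2)$-strategy (for $k_1\le k_2$) accepts the first position $i$ such that either $i>k_1$ and $i$ is a left-to-right maximum, or $i>k_2$ and $i$ is a left-to-right second maximum. $\pi$ is $(k_1,k_2)$-pickable if this strategy makes a selection. $T_1(n,k_1,k_2)=\sum_{\pi\in S_n\text{ not }(k_1,k_2)\text{ -pickable}}\theta^{\mathrm{inv}(\pi)}$.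
   Formalization: The parameter θ ranges over the positive rationals instead of the positive reals. -}

module Defs where

open import Data.Nat as ℕ using (ℕ; zero; suc; _∸_; _<ᵇ_; _≡ᵇ_)
open import Data.Bool using (Bool; true; false; _∧_; _∨_; if_then_else_; not)
open import Data.Maybe using (Maybe; just; nothing; is-just)
open import Data.List using (List; []; _∷_; length; filterᵇ; map; concatMap; foldr; _++_)
open import Data.Fin using (Fin; toℕ)
open import Data.Fin.Properties using (_≟_)
open import Data.Vec as Vec using (Vec; []; _∷_; toList)
open import Data.Rational using (ℚ; 0ℚ; 1ℚ; _+_; _*_)
open import Relation.Nullary.Decidable using (does)

-- Permutations of {1..n}: S n is the list of all injective words
-- π = (π₁ … πₙ) with letters in Fin n (i.e. all bijections Fin n → Fin n,
-- written in one-line notation).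

words : (m n : ℕ) → List (Vec (Fin n) m)
words zero    n = [] ∷ []
words (suc m) n = concatMap (λ w → map (λ a → a ∷ w) (Data.List.allFin n)) (words m n)
  where import Data.List

occurs : ∀ {n m} → Fin n → Vec (Fin n) m → Bool
occurs a []       = false
occurs a (b ∷ w)  = does (a ≟ b) ∨ occurs a w

distinct : ∀ {n m} → Vec (Fin n) m → Bool
distinct []       = true
distinct (a ∷ w)  = not (occurs a w) ∧ distinct w

S : (n : ℕ) → List (Vec (Fin n) n)
S n = filterᵇ distinct (words n n)

-- values of a permutation as natural numbers (order-preserving, so
-- comparisons are the same as for the 1-based values)
vals : ∀ {n} → Vec (Fin n) n → List ℕ
vals π = toList (Vec.map toℕ π)

countBelow : ℕ → List ℕ → ℕ
countBelow x []       = 0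
countBelow x (y ∷ ys) = (if y <ᵇ x then 1 else 0) ℕ.+ countBelow x ys

countAbove : ℕ → List ℕ → ℕ
countAbove x []       = 0
countAbove x (y ∷ ys) = (if x <ᵇ y then 1 else 0) ℕ.+ countAbove x ys

invL : List ℕ → ℕ
invL []       = 0
invL (x ∷ xs) = countBelow x xs ℕ.+ invL xs

inv : ∀ {n} → Vec (Fin n) n → ℕ
inv π = invL (vals π)

-- Position i (1-based) is a left-to-right maximum
-- iff no earlier entry exceeds π_i, and a left-to-right second maximum
-- iff exactly one earlier entry exceeds π_i.

-- scan: i = current 1-based position, pre = entries before position i
scan : (k₁ k₂ : ℕ) → ℕ → List ℕ → List ℕ → Maybe ℕ
scan k₁ k₂ i pre []       = nothing
scan k₁ k₂ i pre (x ∷ xs) =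
  if ((k₁ <ᵇ i) ∧ (countAbove x pre ≡ᵇ 0)) ∨ ((k₂ <ᵇ i) ∧ (countAbove x pre ≡ᵇ 1))
  then just i
  else scan k₁ k₂ (suc i) (x ∷ pre) xs

selection : ∀ {n} → (k₁ k₂ : ℕ) → Vec (Fin n) n → Maybe ℕ
selection k₁ k₂ π = scan k₁ k₂ 1 [] (vals π)

pickable : ∀ {n} → (k₁ k₂ : ℕ) → Vec (Fin n) n → Bool
pickable k₁ k₂ π = is-just (selection k₁ k₂ π)

_^_ : ℚ → ℕ → ℚ
x ^ zero  = 1ℚ
x ^ suc k = x * (x ^ k)

sumℚ : List ℚ → ℚ
sumℚ = foldr _+_ 0ℚ

P : ℚ → ℕ → ℚ
P θ zero    = 0ℚ
P θ (suc n) = (θ ^ n) + P θ n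

Pfact : ℚ → ℕ → ℚ
Pfact θ zero    = 1ℚ
Pfact θ (suc n) = P θ (suc n) * Pfact θ n

T₁ : ℚ → (n k₁ k₂ : ℕ) → ℚ
T₁ θ n k₁ k₂ =
  sumℚ (map (λ π → θ ^ inv π) (filterᵇ (λ π → not (pickable k₁ k₂ π)) (S n)))

{-# OPTIONS --safe #-}
module Submission where

-- Read a permutation from left to right, keeping track of the values still to come: placing c
-- creates one inversion with each smaller value still to come, so θ^inv factorises along the
-- reading and T₁ satisfies a recursion over the set of remaining values.  Nothing is accepted
-- at positions up to k₁.  The largest value N, and N - 1 if it comes first, are left-to-right
-- maxima, so they must appear by position k₁; if N comes first, N - 1 is a left-to-right second
-- maximum and must appear by position k₂.  Once both have appeared every later value has two
-- larger predecessors and is never accepted, so the remaining values contribute (P_{N-2})!,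
-- while the admissible positions of N - 1 and N contribute θ^(2N-k₁-k₂) P_{k₁} P_{k₂-1}.

open import Defs

module T₁-ClosedForm where

  open import Data.Bool using (Bool; true; false; _∧_; _∨_; if_then_else_; not)
  open import Data.Bool.Properties using (T-≡; ∨-zeroʳ; ∧-identityʳ; ∧-zeroʳ)
  open import Data.Empty using (⊥-elim)
  open import Data.Fin using (Fin; toℕ) renaming (zero to fzero; suc to fsuc)
  import Data.Fin.Properties as Finₚ
  open import Data.List
    using (List; []; _∷_; _++_; [_]; length; map; filterᵇ; concatMap; tabulate; allFin; null; upTo)
  open import Data.Bool.ListAction using (all)
  import Data.List.Properties as Listₚ
  open import Data.List.Relation.Unary.All as All using (All; []; _∷_)
  open import Data.List.Relation.Unary.All.Properties using (++⁺; all-upTo)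
  open import Data.List.Relation.Unary.AllPairs using (AllPairs; []; _∷_)
  import Data.List.Relation.Unary.AllPairs.Properties as AllPairsₚ
  open import Data.List.Membership.Propositional using (_∈_)
  open import Data.List.Membership.Propositional.Properties using (∈-upTo⁺; ∈-++⁺ʳ)
  open import Data.List.Relation.Unary.Any using (here; there)
  open import Data.Maybe using (is-just)
  open import Data.Nat using (ℕ; zero; suc; _+_; _∸_; _≤_; _<_; _≡ᵇ_; _<ᵇ_; z≤n; s≤s)
  import Data.Nat.Properties as ℕₚ
  open import Data.Product using (_×_; _,_)
  open import Data.Sum using (_⊎_; inj₁; inj₂)
  open import Data.Rational as ℚ using (ℚ; 0ℚ; 1ℚ; _*_)
  import Data.Rational.Properties as ℚₚ
  import Data.Rational.Solver
  open import Data.Vec as Vec using (Vec; []; _∷_; toList)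
  open import Function using (_∘_; id)
  open import Function.Bundles using (Equivalence)
  open import Relation.Binary.PropositionalEquality hiding ([_])
  open import Relation.Nullary using (yes; no)

  open Equivalence using (to; from)
  open import Algebra.Bundles using (CommutativeMonoid)
  import Algebra.Properties.CommutativeSemigroup as CommSemigroupProperties
  module ℕ+ = CommSemigroupProperties ℕₚ.+-commutativeSemigroup
  module ℚ+ = CommSemigroupProperties (CommutativeMonoid.commutativeSemigroup ℚₚ.+-0-commutativeMonoid)

  ≡ᵇ-refl : ∀ x → (x ≡ᵇ x) ≡ true
  ≡ᵇ-refl x = T-≡ .to (ℕₚ.≡⇒≡ᵇ x x refl)

  ≡ᵇ≡true⇒≡ : ∀ x y → (x ≡ᵇ y) ≡ true → x ≡ y
  ≡ᵇ≡true⇒≡ x y e = ℕₚ.≡ᵇ⇒≡ x y (T-≡ .from e)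

  ≢⇒≡ᵇ≡false : ∀ {x y} → x ≢ y → (x ≡ᵇ y) ≡ false
  ≢⇒≡ᵇ≡false {x} {y} x≢y with x ≡ᵇ y in e
  ... | true  = ⊥-elim (x≢y (≡ᵇ≡true⇒≡ x y e))
  ... | false = refl

  ≡ᵇ-sym : ∀ x y → (x ≡ᵇ y) ≡ (y ≡ᵇ x)
  ≡ᵇ-sym zero    zero    = refl
  ≡ᵇ-sym zero    (suc y) = refl
  ≡ᵇ-sym (suc x) zero    = refl
  ≡ᵇ-sym (suc x) (suc y) = ≡ᵇ-sym x y

  <⇒<ᵇ≡true : ∀ {x y} → x < y → (x <ᵇ y) ≡ true
  <⇒<ᵇ≡true x<y = T-≡ .to (ℕₚ.<⇒<ᵇ x<y)

  <ᵇ≡true⇒< : ∀ x y → (x <ᵇ y) ≡ true → x < y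
  <ᵇ≡true⇒< x y e = ℕₚ.<ᵇ⇒< x y (T-≡ .from e)

  ≤⇒<ᵇ≡false : ∀ {x y} → y ≤ x → (x <ᵇ y) ≡ false
  ≤⇒<ᵇ≡false {x} {y} y≤x with x <ᵇ y in e
  ... | true  = ⊥-elim (ℕₚ.<⇒≱ (<ᵇ≡true⇒< x y e) y≤x)
  ... | false = refl

  m+0≡1+n⇒n<m : ∀ m {n} → m + 0 ≡ suc n → n < m
  m+0≡1+n⇒n<m m m+0≡1+n = subst (_ <_) (trans (sym m+0≡1+n) (ℕₚ.+-identityʳ m)) (ℕₚ.n<1+n _)

  m+[1+o]≡1+n⇒m≤n : ∀ m o {n} → m + suc o ≡ suc n → m ≤ n
  m+[1+o]≡1+n⇒m≤n m o eq =
    ℕₚ.≤-trans (ℕₚ.m≤m+n m o) (ℕₚ.≤-reflexive (ℕₚ.suc-injective (trans (sym (ℕₚ.+-suc m o)) eq)))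

  mem : ℕ → List ℕ → Bool
  mem x []       = false
  mem x (y ∷ ys) = (x ≡ᵇ y) ∨ mem x ys

  delete : ℕ → List ℕ → List ℕ
  delete x []       = []
  delete x (y ∷ ys) = if x ≡ᵇ y then ys else y ∷ delete x ys

  Sorted : List ℕ → Set
  Sorted = AllPairs _<_

  ∈⇒mem : ∀ {x xs} → x ∈ xs → mem x xs ≡ true
  ∈⇒mem {x} (here refl) rewrite ≡ᵇ-refl x = refl
  ∈⇒mem {x} {y ∷ _} (there x∈ys) rewrite ∈⇒mem x∈ys = ∨-zeroʳ (x ≡ᵇ y)

  mem-head : ∀ x ys → mem x (x ∷ ys) ≡ true
  mem-head x ys rewrite ≡ᵇ-refl x = refl

  mem-there : ∀ x y ys → mem x ys ≡ true → mem x (y ∷ ys) ≡ true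
  mem-there x y ys e rewrite e = ∨-zeroʳ (x ≡ᵇ y)

  mem⇒All : ∀ {P : ℕ → Set} {x xs} → All P xs → mem x xs ≡ true → P x
  mem⇒All {x = x} {y ∷ _} (py ∷ pys) e with x ≡ᵇ y in x≡ᵇy
  ... | true  = subst _ (sym (≡ᵇ≡true⇒≡ x y x≡ᵇy)) py
  ... | false = mem⇒All pys e

  All≢⇒mem≡false : ∀ {x xs} → All (x ≢_) xs → mem x xs ≡ false
  All≢⇒mem≡false []                  = refl
  All≢⇒mem≡false (x≢y ∷ x≢ys) rewrite ≢⇒≡ᵇ≡false x≢y = All≢⇒mem≡false x≢ys

  delete-head : ∀ x xs → delete x (x ∷ xs) ≡ xs
  delete-head x xs rewrite ≡ᵇ-refl x = refl

  delete⁺ : ∀ {P : ℕ → Set} x {xs} → All P xs → All P (delete x xs)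
  delete⁺ x []                   = []
  delete⁺ x {y ∷ _} (py ∷ pys) with x ≡ᵇ y
  ... | true  = pys
  ... | false = py ∷ delete⁺ x pys

  delete-sorted : ∀ x {xs} → Sorted xs → Sorted (delete x xs)
  delete-sorted x []                   = []
  delete-sorted x {y ∷ _} (y<ys ∷ ys↑) with x ≡ᵇ y
  ... | true  = ys↑
  ... | false = delete⁺ x y<ys ∷ delete-sorted x ys↑

  length-delete : ∀ x xs → mem x xs ≡ true → suc (length (delete x xs)) ≡ length xs
  length-delete x (y ∷ ys) e with x ≡ᵇ y
  ... | true  = refl
  ... | false = cong suc (length-delete x ys e)

  mem-delete-≢ : ∀ {x y} xs → x ≢ y → mem y xs ≡ true → mem y (delete x xs) ≡ true
  mem-delete-≢ {x} {y} (z ∷ zs) x≢y e with x ≡ᵇ z in x≡ᵇz | y ≡ᵇ z in y≡ᵇz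
  ... | true  | true  = ⊥-elim (x≢y (trans (≡ᵇ≡true⇒≡ x z x≡ᵇz) (sym (≡ᵇ≡true⇒≡ y z y≡ᵇz))))
  ... | true  | false = e
  ... | false | true  rewrite y≡ᵇz = refl
  ... | false | false rewrite y≡ᵇz = mem-delete-≢ zs x≢y e

  mem-delete : ∀ x y {xs} → Sorted xs → mem y (delete x xs) ≡ not (y ≡ᵇ x) ∧ mem y xs
  mem-delete x y [] with y ≡ᵇ x
  ... | true  = refl
  ... | false = refl
  mem-delete x y {z ∷ zs} (z<zs ∷ zs↑) with x ≡ᵇ z in x≡ᵇz
  ... | true with refl ← ≡ᵇ≡true⇒≡ x z x≡ᵇz with y ≡ᵇ x in y≡ᵇx
  ...   | true with refl ← ≡ᵇ≡true⇒≡ y x y≡ᵇx = All≢⇒mem≡false (All.map ℕₚ.<⇒≢ z<zs)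
  ...   | false = refl
  mem-delete x y {z ∷ zs} (z<zs ∷ zs↑) | false rewrite mem-delete x y zs↑ with y ≡ᵇ z in y≡ᵇz
  ...   | false = refl
  ...   | true with refl ← ≡ᵇ≡true⇒≡ y z y≡ᵇz rewrite ≡ᵇ-sym y x | x≡ᵇz = refl

  delete-++ˡ : ∀ x xs ys → mem x xs ≡ true → delete x (xs ++ ys) ≡ delete x xs ++ ys
  delete-++ˡ x (z ∷ zs) ys e with x ≡ᵇ z
  ... | true  = refl
  ... | false = cong (z ∷_) (delete-++ˡ x zs ys e)

  delete-++ʳ : ∀ x xs ys → mem x xs ≡ false → delete x (xs ++ ys) ≡ xs ++ delete x ys
  delete-++ʳ x []       ys e = refl
  delete-++ʳ x (z ∷ zs) ys e with x ≡ᵇ z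
  ... | false = cong (z ∷_) (delete-++ʳ x zs ys e)
  delete-++ʳ x (z ∷ zs) ys () | true

  delete-last : ∀ x xs → mem x xs ≡ false → delete x (xs ++ [ x ]) ≡ xs
  delete-last x xs x∉xs =
    trans (delete-++ʳ x xs [ x ] x∉xs) (trans (cong (xs ++_) (delete-head x [])) (Listₚ.++-identityʳ xs))

  countBelow-++ : ∀ x xs ys → countBelow x (xs ++ ys) ≡ countBelow x xs + countBelow x ys
  countBelow-++ x []       ys = refl
  countBelow-++ x (y ∷ xs) ys rewrite countBelow-++ x xs ys =
    sym (ℕₚ.+-assoc (if y <ᵇ x then 1 else 0) _ _)

  countBelow-all< : ∀ x {xs} → All (_< x) xs → countBelow x xs ≡ length xs
  countBelow-all< x []           = refl
  countBelow-all< x (y<x ∷ ys<x) rewrite <⇒<ᵇ≡true y<x = cong suc (countBelow-all< x ys<x)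

  countBelow-all≥ : ∀ x {xs} → All (x ≤_) xs → countBelow x xs ≡ 0
  countBelow-all≥ x []           = refl
  countBelow-all≥ x (x≤y ∷ x≤ys) rewrite ≤⇒<ᵇ≡false x≤y = countBelow-all≥ x x≤ys

  countBelow-delete : ∀ y x xs → mem x xs ≡ true →
    countBelow y xs ≡ (if x <ᵇ y then 1 else 0) + countBelow y (delete x xs)
  countBelow-delete y x (z ∷ zs) e with x ≡ᵇ z in x≡ᵇz
  ... | true rewrite ≡ᵇ≡true⇒≡ x z x≡ᵇz = refl
  ... | false rewrite countBelow-delete y x zs e =
    ℕ+.x∙yz≈y∙xz (if z <ᵇ y then 1 else 0) (if x <ᵇ y then 1 else 0) _

  countAbove-∷-≤ : ∀ {c y} xs → c ≤ y → countAbove y (c ∷ xs) ≡ countAbove y xs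
  countAbove-∷-≤ xs c≤y rewrite ≤⇒<ᵇ≡false c≤y = refl

  countAbove-∷-< : ∀ {c y} xs → y < c → countAbove y (c ∷ xs) ≡ suc (countAbove y xs)
  countAbove-∷-< xs y<c rewrite <⇒<ᵇ≡true y<c = refl

  <ᵇ-indicator-antimono : ∀ {c y} z → c ≤ y → (if y <ᵇ z then 1 else 0) ≤ (if c <ᵇ z then 1 else 0)
  <ᵇ-indicator-antimono {c} {y} z c≤y with y <ᵇ z in y<ᵇz
  ... | false = z≤n
  ... | true rewrite <⇒<ᵇ≡true (ℕₚ.≤-<-trans c≤y (<ᵇ≡true⇒< y z y<ᵇz)) = ℕₚ.≤-refl

  countAbove-antimono : ∀ {c y} xs → c ≤ y → countAbove y xs ≤ countAbove c xs
  countAbove-antimono []       c≤y = z≤n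
  countAbove-antimono (z ∷ zs) c≤y =
    ℕₚ.+-mono-≤ (<ᵇ-indicator-antimono z c≤y) (countAbove-antimono zs c≤y)

  countAbove-mem : ∀ {c y} xs → c < y → mem y xs ≡ true → suc (countAbove y xs) ≤ countAbove c xs
  countAbove-mem {c} {y} (z ∷ zs) c<y e with y ≡ᵇ z in y≡ᵇz
  ... | true rewrite sym (≡ᵇ≡true⇒≡ y z y≡ᵇz) | <⇒<ᵇ≡true c<y | ≤⇒<ᵇ≡false (ℕₚ.≤-refl {y}) =
    s≤s (countAbove-antimono zs (ℕₚ.<⇒≤ c<y))
  ... | false = ℕₚ.≤-trans (ℕₚ.≤-reflexive (sym (ℕₚ.+-suc (if y <ᵇ z then 1 else 0) _)))
                           (ℕₚ.+-mono-≤ (<ᵇ-indicator-antimono z (ℕₚ.<⇒≤ c<y)) (countAbove-mem zs c<y e))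

  isArrangement : List ℕ → List ℕ → Bool
  isArrangement C []       = null C
  isArrangement C (x ∷ xs) = mem x C ∧ isArrangement (delete x C) xs

  countBelow-arrangement : ∀ C xs → isArrangement C xs ≡ true →
    ∀ y → countBelow y xs ≡ countBelow y C
  countBelow-arrangement [] [] _ y = refl
  countBelow-arrangement C (x ∷ xs) e y with mem x C in x∈C
  ... | true = trans (cong (_ +_) (countBelow-arrangement (delete x C) xs e y))
                     (sym (countBelow-delete y x C x∈C))

  distinctᵇ : List ℕ → Bool
  distinctᵇ []       = true
  distinctᵇ (x ∷ xs) = not (mem x xs) ∧ distinctᵇ xs

  all-mem-delete : ∀ x xs {C} → Sorted C →
    all (λ y → mem y (delete x C)) xs ≡ not (mem x xs) ∧ all (λ y → mem y C) xs
  all-mem-delete x []       C↑ = refl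
  all-mem-delete x (y ∷ ys) {C} C↑
    rewrite mem-delete x y C↑ | all-mem-delete x ys C↑ | ≡ᵇ-sym y x =
    interchange (x ≡ᵇ y) (mem y C) (mem x ys) (all (λ z → mem z C) ys)
    where
    interchange : ∀ a b c d → (not a ∧ b) ∧ (not c ∧ d) ≡ not (a ∨ c) ∧ (b ∧ d)
    interchange true  b c     d = refl
    interchange false b true  d = ∧-zeroʳ b
    interchange false b false d = refl

  isArrangement-sorted : ∀ {C} xs → Sorted C → length xs ≡ length C →
    isArrangement C xs ≡ distinctᵇ xs ∧ all (λ y → mem y C) xs
  isArrangement-sorted {[]} [] C↑ e = refl
  isArrangement-sorted {C} (x ∷ xs) C↑ e with mem x C in x∈C
  ... | false = sym (∧-zeroʳ (not (mem x xs) ∧ distinctᵇ xs))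
  ... | true
    rewrite isArrangement-sorted xs (delete-sorted x C↑)
              (ℕₚ.suc-injective (trans e (sym (length-delete x C x∈C))))
          | all-mem-delete x xs C↑ = rearrange (not (mem x xs)) (distinctᵇ xs) _
    where
    rearrange : ∀ a b c → b ∧ (a ∧ c) ≡ (a ∧ b) ∧ (true ∧ c)
    rearrange true  b c = refl
    rearrange false b c = ∧-zeroʳ b

  toℕs : ∀ {N m} → Vec (Fin N) m → List ℕ
  toℕs w = toList (Vec.map toℕ w)

  length-toℕs : ∀ {N m} (w : Vec (Fin N) m) → length (toℕs w) ≡ m
  length-toℕs []      = refl
  length-toℕs (a ∷ w) = cong suc (length-toℕs w)

  occurs≡mem : ∀ {N m} (a : Fin N) (w : Vec (Fin N) m) → occurs a w ≡ mem (toℕ a) (toℕs w)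
  occurs≡mem a []      = refl
  occurs≡mem a (b ∷ w) rewrite occurs≡mem a w with a Finₚ.≟ b
  ... | yes refl rewrite ≡ᵇ-refl (toℕ a) = refl
  ... | no a≢b   rewrite ≢⇒≡ᵇ≡false (a≢b ∘ Finₚ.toℕ-injective) = refl

  distinct≡distinctᵇ : ∀ {N m} (w : Vec (Fin N) m) → distinct w ≡ distinctᵇ (toℕs w)
  distinct≡distinctᵇ []      = refl
  distinct≡distinctᵇ (a ∷ w) rewrite occurs≡mem a w | distinct≡distinctᵇ w = refl

  upTo-sorted : ∀ N → Sorted (upTo N)
  upTo-sorted N = AllPairsₚ.applyUpTo⁺₁ id N (λ i<j _ → i<j)

  all-mem-upTo : ∀ {N m} (w : Vec (Fin N) m) → all (λ x → mem x (upTo N)) (toℕs w) ≡ true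
  all-mem-upTo []      = refl
  all-mem-upTo (a ∷ w) rewrite ∈⇒mem (∈-upTo⁺ (Finₚ.toℕ<n a)) = all-mem-upTo w

  distinct≡isArrangement-upTo : ∀ {N} (v : Vec (Fin N) N) →
    distinct v ≡ isArrangement (upTo N) (toℕs v)
  distinct≡isArrangement-upTo {N} v
    rewrite isArrangement-sorted (toℕs v) (upTo-sorted N)
              (trans (length-toℕs v) (sym (Listₚ.length-upTo N)))
          | all-mem-upTo v | distinct≡distinctᵇ v = sym (∧-identityʳ _)

  sumℚ-++ : ∀ {A : Set} (f : A → ℚ) xs ys →
    sumℚ (map f (xs ++ ys)) ≡ sumℚ (map f xs) ℚ.+ sumℚ (map f ys)
  sumℚ-++ f []       ys = sym (ℚₚ.+-identityˡ _)
  sumℚ-++ f (x ∷ xs) ys rewrite sumℚ-++ f xs ys = sym (ℚₚ.+-assoc (f x) _ _)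

  sumℚ-∷ʳ : ∀ {A : Set} (f : A → ℚ) xs x → sumℚ (map f (xs ++ [ x ])) ≡ sumℚ (map f xs) ℚ.+ f x
  sumℚ-∷ʳ f xs x = trans (sumℚ-++ f xs [ x ]) (cong (sumℚ (map f xs) ℚ.+_) (ℚₚ.+-identityʳ (f x)))

  sumℚ-cong : ∀ {A : Set} {f g : A → ℚ} xs → (∀ x → f x ≡ g x) →
    sumℚ (map f xs) ≡ sumℚ (map g xs)
  sumℚ-cong []       f≗g = refl
  sumℚ-cong (x ∷ xs) f≗g = cong₂ ℚ._+_ (f≗g x) (sumℚ-cong xs f≗g)

  sumℚ-cong-mem : ∀ {f g : ℕ → ℚ} xs → (∀ x → mem x xs ≡ true → f x ≡ g x) →
    sumℚ (map f xs) ≡ sumℚ (map g xs)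
  sumℚ-cong-mem []       f≗g = refl
  sumℚ-cong-mem (x ∷ xs) f≗g =
    cong₂ ℚ._+_ (f≗g x (mem-head x xs)) (sumℚ-cong-mem xs (λ y e → f≗g y (mem-there y x xs e)))

  sumℚ-*ˡ : ∀ {A : Set} (f : A → ℚ) k xs → sumℚ (map (λ x → k * f x) xs) ≡ k * sumℚ (map f xs)
  sumℚ-*ˡ f k []       = sym (ℚₚ.*-zeroʳ k)
  sumℚ-*ˡ f k (x ∷ xs) rewrite sumℚ-*ˡ f k xs = sym (ℚₚ.*-distribˡ-+ k (f x) _)

  sumℚ-*ʳ : ∀ {A : Set} (f : A → ℚ) k xs → sumℚ (map (λ x → f x * k) xs) ≡ sumℚ (map f xs) * k
  sumℚ-*ʳ f k []       = sym (ℚₚ.*-zeroˡ k)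
  sumℚ-*ʳ f k (x ∷ xs) rewrite sumℚ-*ʳ f k xs = sym (ℚₚ.*-distribʳ-+ k (f x) _)

  sumℚ-zero : ∀ {A : Set} (xs : List A) → sumℚ (map (λ _ → 0ℚ) xs) ≡ 0ℚ
  sumℚ-zero []       = refl
  sumℚ-zero (x ∷ xs) rewrite sumℚ-zero xs = refl

  sumℚ-concatMap : ∀ {A B : Set} (f : B → ℚ) (F : A → List B) xs →
    sumℚ (map f (concatMap F xs)) ≡ sumℚ (map (λ x → sumℚ (map f (F x))) xs)
  sumℚ-concatMap f F []       = refl
  sumℚ-concatMap f F (x ∷ xs) rewrite sumℚ-++ f (F x) (concatMap F xs) | sumℚ-concatMap f F xs = refl

  sumℚ-filterᵇ : ∀ {A : Set} (f : A → ℚ) (p : A → Bool) xs →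
    sumℚ (map f (filterᵇ p xs)) ≡ sumℚ (map (λ x → if p x then f x else 0ℚ) xs)
  sumℚ-filterᵇ f p []       = refl
  sumℚ-filterᵇ f p (x ∷ xs) with p x
  ... | true  = cong (f x ℚ.+_) (sumℚ-filterᵇ f p xs)
  ... | false = trans (sumℚ-filterᵇ f p xs) (sym (ℚₚ.+-identityˡ _))

  sumFin : (N : ℕ) → (Fin N → ℚ) → ℚ
  sumFin zero    f = 0ℚ
  sumFin (suc N) f = f fzero ℚ.+ sumFin N (f ∘ fsuc)

  sumFin-cong : ∀ N {f g : Fin N → ℚ} → (∀ a → f a ≡ g a) → sumFin N f ≡ sumFin N g
  sumFin-cong zero    f≗g = refl
  sumFin-cong (suc N) f≗g = cong₂ ℚ._+_ (f≗g fzero) (sumFin-cong N (f≗g ∘ fsuc))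

  sumFin-zero : ∀ N → sumFin N (λ _ → 0ℚ) ≡ 0ℚ
  sumFin-zero zero    = refl
  sumFin-zero (suc N) rewrite sumFin-zero N = refl

  sumFin-+ : ∀ N (f g : Fin N → ℚ) → sumFin N (λ a → f a ℚ.+ g a) ≡ sumFin N f ℚ.+ sumFin N g
  sumFin-+ zero    f g = refl
  sumFin-+ (suc N) f g rewrite sumFin-+ N (f ∘ fsuc) (g ∘ fsuc) =
    ℚ+.interchange (f fzero) (g fzero) (sumFin N (f ∘ fsuc)) (sumFin N (g ∘ fsuc))

  sumℚ-tabulate : ∀ {A : Set} N (f : A → ℚ) (g : Fin N → A) →
    sumℚ (map f (tabulate g)) ≡ sumFin N (f ∘ g)
  sumℚ-tabulate zero    f g = refl
  sumℚ-tabulate (suc N) f g = cong (f (g fzero) ℚ.+_) (sumℚ-tabulate N f (g ∘ fsuc))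

  sumℚ-sumFin-comm : ∀ {A : Set} N (g : A → Fin N → ℚ) xs →
    sumℚ (map (λ x → sumFin N (g x)) xs) ≡ sumFin N (λ a → sumℚ (map (λ x → g x a) xs))
  sumℚ-sumFin-comm N g []       = sym (sumFin-zero N)
  sumℚ-sumFin-comm N g (x ∷ xs) rewrite sumℚ-sumFin-comm N g xs =
    sym (sumFin-+ N (g x) (λ a → sumℚ (map (λ y → g y a) xs)))

  sumℚ-words-suc : ∀ N m (h : Vec (Fin N) (suc m) → ℚ) →
    sumℚ (map h (words (suc m) N)) ≡ sumFin N (λ a → sumℚ (map (λ w → h (a ∷ w)) (words m N)))
  sumℚ-words-suc N m h = begin
    sumℚ (map h (words (suc m) N))
      ≡⟨ sumℚ-concatMap h (λ w → map (_∷ w) (allFin N)) (words m N) ⟩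
    sumℚ (map (λ w → sumℚ (map h (map (_∷ w) (allFin N)))) (words m N))
      ≡⟨ sumℚ-cong (words m N) (λ w → trans (cong sumℚ (sym (Listₚ.map-∘ (allFin N))))
                                            (sumℚ-tabulate N (λ a → h (a ∷ w)) id)) ⟩
    sumℚ (map (λ w → sumFin N (λ a → h (a ∷ w))) (words m N))
      ≡⟨ sumℚ-sumFin-comm N (λ w a → h (a ∷ w)) (words m N) ⟩
    sumFin N (λ a → sumℚ (map (λ w → h (a ∷ w)) (words m N))) ∎
    where open ≡-Reasoning

  sumFin-indicator : ∀ N {c} → c < N → (φ : ℕ → ℚ) →
    sumFin N (λ a → if toℕ a ≡ᵇ c then φ (toℕ a) else 0ℚ) ≡ φ c
  sumFin-indicator (suc N) {zero}  _         φ rewrite sumFin-zero N = ℚₚ.+-identityʳ _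
  sumFin-indicator (suc N) {suc c} (s≤s c<N) φ =
    trans (ℚₚ.+-identityˡ _) (sumFin-indicator N c<N (φ ∘ suc))

  sumFin-mem : ∀ N {C} → Sorted C → All (_< N) C → (φ : ℕ → ℚ) →
    sumFin N (λ a → if mem (toℕ a) C then φ (toℕ a) else 0ℚ) ≡ sumℚ (map φ C)
  sumFin-mem N []               []           φ = sumFin-zero N
  sumFin-mem N {c ∷ C} (c<C ∷ C↑) (c<N ∷ C<N) φ = begin
    sumFin N (λ a → if mem (toℕ a) (c ∷ C) then φ (toℕ a) else 0ℚ)
      ≡⟨ sumFin-cong N (λ a → split (toℕ a)) ⟩
    sumFin N (λ a → (if toℕ a ≡ᵇ c then φ (toℕ a) else 0ℚ) ℚ.+ (if mem (toℕ a) C then φ (toℕ a) else 0ℚ))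
      ≡⟨ sumFin-+ N _ _ ⟩
    _ ≡⟨ cong₂ ℚ._+_ (sumFin-indicator N c<N φ) (sumFin-mem N C↑ C<N φ) ⟩
    φ c ℚ.+ sumℚ (map φ C) ∎
    where
    open ≡-Reasoning
    split : ∀ x → (if (x ≡ᵇ c) ∨ mem x C then φ x else 0ℚ)
                ≡ (if x ≡ᵇ c then φ x else 0ℚ) ℚ.+ (if mem x C then φ x else 0ℚ)
    split x with x ≡ᵇ c in x≡ᵇc
    ... | false = sym (ℚₚ.+-identityˡ _)
    ... | true with refl ← ≡ᵇ≡true⇒≡ x c x≡ᵇc
      rewrite All≢⇒mem≡false (All.map ℕₚ.<⇒≢ c<C) = sym (ℚₚ.+-identityʳ _)

  ^-distribˡ-+-* : ∀ θ a b → θ ^ (a + b) ≡ θ ^ a * θ ^ b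
  ^-distribˡ-+-* θ zero    b = sym (ℚₚ.*-identityˡ _)
  ^-distribˡ-+-* θ (suc a) b rewrite ^-distribˡ-+-* θ a b = sym (ℚₚ.*-assoc θ _ _)

  -- The strategy as a recursion on the values still to come

  module Strategy (θ : ℚ) (k₁ k₂ : ℕ) where

    -- pre lists the values at positions 1 … i-1, latest first, and C the values still to
    -- come; unpicked m C pre i is the θ^inv-weighted count of the arrangements of C (with
    -- m = |C|) that the strategy lets pass.
    accepts : ℕ → List ℕ → ℕ → Bool
    accepts i pre x = ((k₁ <ᵇ i) ∧ (countAbove x pre ≡ᵇ 0)) ∨ ((k₂ <ᵇ i) ∧ (countAbove x pre ≡ᵇ 1))

    step : List ℕ → List ℕ → ℕ → ℕ → ℚ
    step C pre i c = if accepts i pre c then 0ℚ else θ ^ countBelow c (delete c C)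

    step-accepted : ∀ C pre i c → accepts i pre c ≡ true → step C pre i c ≡ 0ℚ
    step-accepted C pre i c accepted rewrite accepted = refl

    step-rejected : ∀ C pre i c → accepts i pre c ≡ false →
      step C pre i c ≡ θ ^ countBelow c (delete c C)
    step-rejected C pre i c rejected rewrite rejected = refl

    unpicked : ℕ → List ℕ → List ℕ → ℕ → ℚ
    unpicked zero    C pre i = if null C then 1ℚ else 0ℚ
    unpicked (suc m) C pre i =
      sumℚ (map (λ c → step C pre i c * unpicked m (delete c C) (c ∷ pre) (suc i)) C)

    unpickedWeight : List ℕ → List ℕ → ℕ → List ℕ → ℚ
    unpickedWeight C pre i xs =
      if isArrangement C xs
      then (if is-just (scan k₁ k₂ i pre xs) then 0ℚ else θ ^ invL xs)
      else 0ℚ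

    unpickedWeight-∷ : ∀ C pre i x xs →
      unpickedWeight C pre i (x ∷ xs)
        ≡ (if mem x C then step C pre i x else 0ℚ) * unpickedWeight (delete x C) (x ∷ pre) (suc i) xs
    unpickedWeight-∷ C pre i x xs with mem x C
    ... | false = sym (ℚₚ.*-zeroˡ (unpickedWeight (delete x C) (x ∷ pre) (suc i) xs))
    ... | true with isArrangement (delete x C) xs in arr
    ...   | false = sym (ℚₚ.*-zeroʳ (step C pre i x))
    ...   | true with accepts i pre x
    ...     | true =
      sym (ℚₚ.*-zeroˡ (if is-just (scan k₁ k₂ (suc i) (x ∷ pre) xs) then 0ℚ else θ ^ invL xs))
    ...     | false with is-just (scan k₁ k₂ (suc i) (x ∷ pre) xs)
    ...       | true  = sym (ℚₚ.*-zeroʳ (θ ^ countBelow x (delete x C)))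
    ...       | false rewrite countBelow-arrangement (delete x C) xs arr x =
      ^-distribˡ-+-* θ (countBelow x (delete x C)) (invL xs)

    sumℚ-unpickedWeight : ∀ N m {C} pre i → Sorted C → All (_< N) C →
      sumℚ (map (unpickedWeight C pre i ∘ toℕs) (words m N)) ≡ unpicked m C pre i
    sumℚ-unpickedWeight N zero    pre i C↑ C<N = ℚₚ.+-identityʳ _
    sumℚ-unpickedWeight N (suc m) {C} pre i C↑ C<N = begin
      sumℚ (map (unpickedWeight C pre i ∘ toℕs) (words (suc m) N))
        ≡⟨ sumℚ-words-suc N m _ ⟩
      sumFin N (λ a → sumℚ (map (λ w → unpickedWeight C pre i (toℕ a ∷ toℕs w)) (words m N)))
        ≡⟨ sumFin-cong N (λ a →
             trans (sumℚ-cong (words m N) (λ w → unpickedWeight-∷ C pre i (toℕ a) (toℕs w)))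
                   (sumℚ-*ˡ _ (first (toℕ a)) (words m N))) ⟩
      sumFin N (λ a → first (toℕ a) * sumℚ (map (rest (toℕ a) ∘ toℕs) (words m N)))
        ≡⟨ sumFin-cong N (λ a → cong (first (toℕ a) *_)
             (sumℚ-unpickedWeight N m (toℕ a ∷ pre) (suc i)
               (delete-sorted (toℕ a) C↑) (delete⁺ (toℕ a) C<N))) ⟩
      sumFin N (λ a → first (toℕ a) * unpicked m (delete (toℕ a) C) (toℕ a ∷ pre) (suc i))
        ≡⟨ sumFin-cong N (λ a → pull-indicator (toℕ a)) ⟩
      sumFin N (λ a → if mem (toℕ a) C then term (toℕ a) else 0ℚ)
        ≡⟨ sumFin-mem N C↑ C<N term ⟩
      unpicked (suc m) C pre i ∎
      where
      open ≡-Reasoning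
      first : ℕ → ℚ
      first x = if mem x C then step C pre i x else 0ℚ
      rest : ℕ → List ℕ → ℚ
      rest x = unpickedWeight (delete x C) (x ∷ pre) (suc i)
      term : ℕ → ℚ
      term c = step C pre i c * unpicked m (delete c C) (c ∷ pre) (suc i)
      pull-indicator : ∀ x → first x * unpicked m (delete x C) (x ∷ pre) (suc i)
                             ≡ (if mem x C then term x else 0ℚ)
      pull-indicator x with mem x C
      ... | true  = refl
      ... | false = ℚₚ.*-zeroˡ (unpicked m (delete x C) (x ∷ pre) (suc i))

    T₁≡unpicked : ∀ N → T₁ θ N k₁ k₂ ≡ unpicked N (upTo N) [] 1
    T₁≡unpicked N = begin
      T₁ θ N k₁ k₂
        ≡⟨ sumℚ-filterᵇ _ _ (filterᵇ distinct (words N N)) ⟩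
      _ ≡⟨ sumℚ-filterᵇ _ distinct (words N N) ⟩
      _ ≡⟨ sumℚ-cong (words N N) weight-as-unpickedWeight ⟩
      _ ≡⟨ sumℚ-unpickedWeight N N [] 1 (upTo-sorted N) (all-upTo N) ⟩
      unpicked N (upTo N) [] 1 ∎
      where
      open ≡-Reasoning
      weight-as-unpickedWeight : ∀ (v : Vec (Fin N) N) →
        (if distinct v then (if not (pickable k₁ k₂ v) then θ ^ inv v else 0ℚ) else 0ℚ)
          ≡ unpickedWeight (upTo N) [] 1 (toℕs v)
      weight-as-unpickedWeight v rewrite distinct≡isArrangement-upTo v
        with isArrangement (upTo N) (toℕs v)
      ... | false = refl
      ... | true with pickable k₁ k₂ v
      ...   | true  = refl
      ...   | false = refl

  P-suc : ∀ θ k → P θ (suc k) ≡ 1ℚ ℚ.+ θ * P θ k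
  P-suc θ zero    = cong (1ℚ ℚ.+_) (sym (ℚₚ.*-zeroʳ θ))
  P-suc θ (suc k) = begin
    θ * θ ^ k ℚ.+ P θ (suc k)          ≡⟨ cong (θ * θ ^ k ℚ.+_) (P-suc θ k) ⟩
    θ * θ ^ k ℚ.+ (1ℚ ℚ.+ θ * P θ k)   ≡⟨ ℚ+.x∙yz≈y∙xz (θ * θ ^ k) 1ℚ (θ * P θ k) ⟩
    1ℚ ℚ.+ (θ * θ ^ k ℚ.+ θ * P θ k)   ≡⟨ cong (1ℚ ℚ.+_) (sym (ℚₚ.*-distribˡ-+ θ (θ ^ k) (P θ k))) ⟩
    1ℚ ℚ.+ θ * P θ (suc k)             ∎
    where open ≡-Reasoning

  sum-θ^rank : ∀ θ {D} → Sorted D →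
    sumℚ (map (λ c → θ ^ countBelow c (delete c D)) D) ≡ P θ (length D)
  sum-θ^rank θ []                 = refl
  sum-θ^rank θ {d ∷ D} (d<D ∷ D↑) = begin
    θ ^ countBelow d (delete d (d ∷ D)) ℚ.+ sumℚ (map (λ c → θ ^ countBelow c (delete c (d ∷ D))) D)
      ≡⟨ cong₂ ℚ._+_ first-term (sumℚ-cong-mem D other-term) ⟩
    1ℚ ℚ.+ sumℚ (map (λ c → θ * θ ^ countBelow c (delete c D)) D)
      ≡⟨ cong (1ℚ ℚ.+_) (trans (sumℚ-*ˡ _ θ D) (cong (θ *_) (sum-θ^rank θ D↑))) ⟩
    1ℚ ℚ.+ θ * P θ (length D)
      ≡⟨ sym (P-suc θ (length D)) ⟩
    P θ (suc (length D)) ∎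
    where
    open ≡-Reasoning
    first-term : θ ^ countBelow d (delete d (d ∷ D)) ≡ 1ℚ
    first-term rewrite delete-head d D | countBelow-all≥ d (All.map ℕₚ.<⇒≤ d<D) = refl
    other-term : ∀ c → mem c D ≡ true →
      θ ^ countBelow c (delete c (d ∷ D)) ≡ θ * θ ^ countBelow c (delete c D)
    other-term c c∈D
      rewrite ≢⇒≡ᵇ≡false (ℕₚ.>⇒≢ (mem⇒All d<D c∈D)) | <⇒<ᵇ≡true (mem⇒All d<D c∈D) = refl

  open Data.Rational.Solver.+-*-Solver

  one-threat-algebra : ∀ θ j e q → q ≡ j + e →
    P θ q * (θ ^ e * P θ j * Pfact θ (q ∸ 1)) ℚ.+ θ ^ q * Pfact θ q ≡ θ ^ e * P θ (suc j) * Pfact θ q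
  one-threat-algebra θ zero    zero    zero    _  = refl
  one-threat-algebra θ (suc j) e       zero    ()
  one-threat-algebra θ zero    (suc e) zero    ()
  one-threat-algebra θ j       e       (suc q) q≡j+e = begin
    V * (θ ^ e * P θ j * W) ℚ.+ θ ^ suc q * (V * W)
      ≡⟨ cong (λ x → V * (θ ^ e * P θ j * W) ℚ.+ x * (V * W))
              (trans (cong (θ ^_) q≡j+e) (^-distribˡ-+-* θ j e)) ⟩
    V * (θ ^ e * P θ j * W) ℚ.+ θ ^ j * θ ^ e * (V * W)
      ≡⟨ solve 5 (λ V E Pj W J → V :* (E :* Pj :* W) :+ J :* E :* (V :* W) := E :* (J :+ Pj) :* (V :* W))
               refl V (θ ^ e) (P θ j) W (θ ^ j) ⟩
    θ ^ e * P θ (suc j) * (V * W) ∎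
    where
    open ≡-Reasoning
    V W : ℚ
    V = P θ (suc q)
    W = Pfact θ q

  two-threats-algebra : ∀ θ d s e q → suc q ≡ d + s + e →
    P θ q * (θ ^ (s + e + e) * P θ d * P θ ((d + s) ∸ 1) * Pfact θ (q ∸ 1))
      ℚ.+ (θ ^ q * (θ ^ (s + e) * P θ d * Pfact θ q)
      ℚ.+ (θ ^ suc q * (θ ^ e * P θ (d + s) * Pfact θ q) ℚ.+ 0ℚ))
    ≡ θ ^ (s + e + e) * P θ (suc d) * P θ (d + s) * Pfact θ q
  two-threats-algebra θ zero s e q q+1≡s+e =
    identity (trans (^-distribˡ-+-* θ (s + e) e) (cong (λ m → θ ^ m * θ ^ e) (sym q+1≡s+e)))
    where
    identity : ∀ {X} → X ≡ θ ^ suc q * θ ^ e →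
      P θ q * (X * 0ℚ * P θ (s ∸ 1) * Pfact θ (q ∸ 1))
        ℚ.+ (θ ^ q * (θ ^ (s + e) * 0ℚ * Pfact θ q) ℚ.+ (θ ^ suc q * (θ ^ e * P θ s * Pfact θ q) ℚ.+ 0ℚ))
      ≡ X * (1ℚ ℚ.+ 0ℚ) * P θ s * Pfact θ q
    identity refl =
      solve 9 (λ Pq Fq₋ Ps₋ Tq Tse Tq₁ Te Ps Fq →
                 Pq :* (Tq₁ :* Te :* con 0ℚ :* Ps₋ :* Fq₋)
                   :+ (Tq :* (Tse :* con 0ℚ :* Fq) :+ (Tq₁ :* (Te :* Ps :* Fq) :+ con 0ℚ))
                 := Tq₁ :* Te :* (con 1ℚ :+ con 0ℚ) :* Ps :* Fq)
              refl (P θ q) (Pfact θ (q ∸ 1)) (P θ (s ∸ 1)) (θ ^ q) (θ ^ (s + e)) (θ ^ suc q) (θ ^ e)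
              (P θ s) (Pfact θ q)
  two-threats-algebra θ (suc zero) zero zero zero refl =
    solve 1 (λ t → con 0ℚ :* (con 1ℚ :* (con 1ℚ :+ con 0ℚ) :* con 0ℚ :* con 1ℚ)
                     :+ (con 1ℚ :* (con 1ℚ :* (con 1ℚ :+ con 0ℚ) :* con 1ℚ)
                     :+ (t :* con 1ℚ :* (con 1ℚ :* (con 1ℚ :+ con 0ℚ) :* con 1ℚ) :+ con 0ℚ))
                   := con 1ℚ :* (t :* con 1ℚ :+ (con 1ℚ :+ con 0ℚ)) :* (con 1ℚ :+ con 0ℚ) :* con 1ℚ)
          refl θ
  two-threats-algebra θ (suc a) s e (suc q) q+2≡d+s+e =
    identity (trans (^-distribˡ-+-* θ (s + e) e) (cong (_* θᵉ) (^-distribˡ-+-* θ s e)))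
             (^-distribˡ-+-* θ s e)
             (trans (cong (θ ^_) (ℕₚ.suc-injective q+2≡d+s+e))
                    (trans (^-distribˡ-+-* θ (a + s) e) (cong (_* θᵉ) (^-distribˡ-+-* θ a s))))
             (^-distribˡ-+-* θ a s)
    where
    θᵃ θˢ θᵉ Pd U V W : ℚ
    θᵃ = θ ^ a
    θˢ = θ ^ s
    θᵉ = θ ^ e
    Pd = P θ (suc a)
    U = P θ (a + s)
    V = P θ (suc q)
    W = Pfact θ q
    identity : ∀ {X Y Z T} → X ≡ θˢ * θᵉ * θᵉ → Y ≡ θˢ * θᵉ → Z ≡ θᵃ * θˢ * θᵉ → T ≡ θᵃ * θˢ →
      V * (X * Pd * U * W) ℚ.+ (Z * (Y * Pd * (V * W)) ℚ.+ (θ * Z * (θᵉ * (T ℚ.+ U) * (V * W)) ℚ.+ 0ℚ))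
      ≡ X * (θ * θᵃ ℚ.+ Pd) * (T ℚ.+ U) * (V * W)
    identity refl refl refl refl =
      solve 8 (λ t A S E Pd U V W →
                 V :* (S :* E :* E :* Pd :* U :* W)
                   :+ (A :* S :* E :* (S :* E :* Pd :* (V :* W))
                   :+ (t :* (A :* S :* E) :* (E :* (A :* S :+ U) :* (V :* W)) :+ con 0ℚ))
                 := S :* E :* E :* (t :* A :+ Pd) :* (A :* S :+ U) :* (V :* W))
              refl θ θᵃ θˢ θᵉ Pd U V W

  module Evaluation (θ : ℚ) (k₁ k₂ : ℕ) (k₁≤k₂ : k₁ ≤ k₂) where
    open Strategy θ k₁ k₂

    accepts-max : ∀ i pre x → k₁ < i → countAbove x pre ≡ 0 → accepts i pre x ≡ true
    accepts-max i pre x k₁<i ≡0 rewrite ≡0 | <⇒<ᵇ≡true k₁<i = refl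

    accepts-second : ∀ i pre x → k₂ < i → countAbove x pre ≡ 1 → accepts i pre x ≡ true
    accepts-second i pre x k₂<i ≡1 rewrite ≡1 | <⇒<ᵇ≡true k₂<i = ∨-zeroʳ ((k₁ <ᵇ i) ∧ false)

    rejects-early : ∀ i pre x → i ≤ k₁ → accepts i pre x ≡ false
    rejects-early i pre x i≤k₁
      rewrite ≤⇒<ᵇ≡false i≤k₁ | ≤⇒<ᵇ≡false {k₂} {i} (ℕₚ.≤-trans i≤k₁ k₁≤k₂) = refl

    rejects-covered : ∀ i pre x → i ≤ k₂ → 1 ≤ countAbove x pre → accepts i pre x ≡ false
    rejects-covered i pre x i≤k₂ 1≤count rewrite ≤⇒<ᵇ≡false {k₂} {i} i≤k₂
      with countAbove x pre | 1≤count
    ... | suc _ | _ = cong (_∨ false) (∧-zeroʳ (k₁ <ᵇ i))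

    rejects-dominated : ∀ i pre x → 2 ≤ countAbove x pre → accepts i pre x ≡ false
    rejects-dominated i pre x 2≤count with countAbove x pre | 2≤count
    ... | suc zero    | s≤s ()
    ... | suc (suc _) | _ = cong₂ _∨_ (∧-zeroʳ (k₁ <ᵇ i)) (∧-zeroʳ (k₂ <ᵇ i))

    Dominated : ℕ → List ℕ → Set
    Dominated n pre = ∀ {c} → c < n → 2 ≤ countAbove c pre

    Dominated-∷ : ∀ {n t y pre} → n ≤ t → n ≤ y → mem y pre ≡ true → Dominated n (t ∷ pre)
    Dominated-∷ {pre = pre} n≤t n≤y y∈pre {c} c<n
      rewrite countAbove-∷-< pre (ℕₚ.<-≤-trans c<n n≤t) =
      s≤s (ℕₚ.≤-trans (s≤s z≤n) (countAbove-mem pre (ℕₚ.<-≤-trans c<n n≤y) y∈pre))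

    unpicked-dominated : ∀ {n} m {D} pre i → Sorted D → length D ≡ m → All (_< n) D →
      Dominated n pre → unpicked m D pre i ≡ Pfact θ m
    unpicked-dominated zero    {[]}    pre i _  _  _   _   = refl
    unpicked-dominated (suc m) {D}     pre i D↑ |D| D<n dom = begin
      unpicked (suc m) D pre i
        ≡⟨ sumℚ-cong-mem D term ⟩
      sumℚ (map (λ c → θ ^ countBelow c (delete c D) * Pfact θ m) D)
        ≡⟨ sumℚ-*ʳ _ (Pfact θ m) D ⟩
      sumℚ (map (λ c → θ ^ countBelow c (delete c D)) D) * Pfact θ m
        ≡⟨ cong (_* Pfact θ m) (trans (sum-θ^rank θ D↑) (cong (P θ) |D|)) ⟩
      Pfact θ (suc m) ∎
      where
      open ≡-Reasoning
      term : ∀ c → mem c D ≡ true →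
        step D pre i c * unpicked m (delete c D) (c ∷ pre) (suc i)
          ≡ θ ^ countBelow c (delete c D) * Pfact θ m
      term c c∈D =
        cong₂ _*_ (step-rejected D pre i c (rejects-dominated i pre c (dom (mem⇒All D<n c∈D))))
          (unpicked-dominated m (c ∷ pre) (suc i) (delete-sorted c D↑)
            (ℕₚ.suc-injective (trans (length-delete c D c∈D) |D|)) (delete⁺ c D<n)
            (λ c′<n → ℕₚ.≤-trans (dom c′<n) (ℕₚ.m≤n+m _ _)))

    sum-smaller-first : ∀ {n} m {D} T pre i (K : ℚ) → Sorted D → All (_< n) D → All (n ≤_) T →
      (∀ c → c < n → accepts i pre c ≡ false) →
      (∀ c → mem c D ≡ true → unpicked m (delete c D ++ T) (c ∷ pre) (suc i) ≡ K) →
      sumℚ (map (λ c → step (D ++ T) pre i c * unpicked m (delete c (D ++ T)) (c ∷ pre) (suc i)) D)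
        ≡ P θ (length D) * K
    sum-smaller-first m {D} T pre i K D↑ D<n n≤T quiet rest = begin
      sumℚ (map (λ c → step (D ++ T) pre i c * unpicked m (delete c (D ++ T)) (c ∷ pre) (suc i)) D)
        ≡⟨ sumℚ-cong-mem D term ⟩
      sumℚ (map (λ c → θ ^ countBelow c (delete c D) * K) D)
        ≡⟨ sumℚ-*ʳ _ K D ⟩
      sumℚ (map (λ c → θ ^ countBelow c (delete c D)) D) * K
        ≡⟨ cong (_* K) (sum-θ^rank θ D↑) ⟩
      P θ (length D) * K ∎
      where
      open ≡-Reasoning
      term : ∀ c → mem c D ≡ true →
        step (D ++ T) pre i c * unpicked m (delete c (D ++ T)) (c ∷ pre) (suc i)
          ≡ θ ^ countBelow c (delete c D) * K
      term c c∈D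
        rewrite step-rejected (D ++ T) pre i c (quiet c (mem⇒All D<n c∈D)) | delete-++ˡ c D T c∈D
              | countBelow-++ c (delete c D) T
              | countBelow-all≥ c (All.map (λ n≤y → ℕₚ.<⇒≤ (ℕₚ.<-≤-trans (mem⇒All D<n c∈D) n≤y)) n≤T)
              | ℕₚ.+-identityʳ (countBelow c (delete c D)) =
        cong (θ ^ countBelow c (delete c D) *_) (rest c c∈D)

    module Doomed (t : ℕ) (J : List ℕ → ℕ → Set)
      (t-accepted : ∀ pre i → J pre i → accepts i pre t ≡ true)
      (J-step : ∀ pre i c → J pre i → c < t → accepts i pre c ≡ true ⊎ J (c ∷ pre) (suc i))
      where

      unpicked-doomed : ∀ m {C} pre i → mem t C ≡ true → All (_≤ t) C → J pre i → unpicked m C pre i ≡ 0ℚ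
      unpicked-doomed zero    {_ ∷ _} pre i _ _ _ = refl
      unpicked-doomed (suc m) {C}     pre i t∈C C≤t j = trans (sumℚ-cong-mem C term) (sumℚ-zero C)
        where
        rest : ℕ → ℚ
        rest c = unpicked m (delete c C) (c ∷ pre) (suc i)
        term : ∀ c → mem c C ≡ true → step C pre i c * rest c ≡ 0ℚ
        term c c∈C with c ℕₚ.≟ t
        ... | yes refl rewrite step-accepted C pre i c (t-accepted pre i j) = ℚₚ.*-zeroˡ (rest c)
        ... | no c≢t with J-step pre i c j (ℕₚ.≤∧≢⇒< (mem⇒All C≤t c∈C) c≢t)
        ...   | inj₁ accepted rewrite step-accepted C pre i c accepted = ℚₚ.*-zeroˡ (rest c)
        ...   | inj₂ j′
          rewrite unpicked-doomed m (c ∷ pre) (suc i) (mem-delete-≢ C c≢t t∈C) (delete⁺ c C≤t) j′ =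
          ℚₚ.*-zeroʳ (step C pre i c)

    module OneThreat (n t k : ℕ) (n≤t : n ≤ t) (Inv : List ℕ → Set)
      (quiet : ∀ pre i c → Inv pre → i ≤ k → c ≤ t → accepts i pre c ≡ false)
      (Inv-step : ∀ pre c → Inv pre → c < t → Inv (c ∷ pre))
      (t-dominates : ∀ pre → Inv pre → Dominated n (t ∷ pre))
      (t-accepted : ∀ pre i → Inv pre → k < i → accepts i pre t ≡ true)
      where

      open Doomed t (λ pre i → k < i × Inv pre) (λ pre i (k<i , inv) → t-accepted pre i inv k<i)
        (λ pre i c (k<i , inv) c<t → inj₂ (ℕₚ.m<n⇒m<1+n k<i , Inv-step pre c inv c<t))

      -- t has to come within the d positions i, …, k; in the j-th of them it precedes
      -- |D| + 1 - j smaller values, and Σ_{j ≤ d} θ^(|D|+1-j) = θ^e P_d.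
      unpicked-one-threat : ∀ d e {D} pre i → Sorted D → All (_< n) D →
        suc (length D) ≡ d + e → i + d ≡ suc k → Inv pre →
        unpicked (suc (length D)) (D ++ [ t ]) pre i ≡ θ ^ e * P θ d * Pfact θ (length D)
      unpicked-one-threat zero e {D} pre i D↑ D<n _ i+0≡k+1 inv =
        trans (unpicked-doomed (suc (length D)) pre i (∈⇒mem {t} {D ++ [ t ]} (∈-++⁺ʳ D (here refl)))
                 (++⁺ (All.map (λ c<n → ℕₚ.<⇒≤ (ℕₚ.<-≤-trans c<n n≤t)) D<n) (ℕₚ.≤-refl ∷ []))
                 (m+0≡1+n⇒n<m i i+0≡k+1 , inv))
          (sym (trans (cong (_* Pfact θ (length D)) (ℚₚ.*-zeroʳ (θ ^ e)))
                      (ℚₚ.*-zeroˡ (Pfact θ (length D)))))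
      unpicked-one-threat (suc j) e {D} pre i D↑ D<n |D|+1≡ i+d≡k+1 inv = begin
        unpicked (suc (length D)) (D ++ [ t ]) pre i
          ≡⟨ sumℚ-∷ʳ _ D t ⟩
        _ ≡⟨ cong₂ ℚ._+_ (sum-smaller-first (length D) [ t ] pre i K D↑ D<n (n≤t ∷ [])
                            (λ c c<n → quiet pre i c inv i≤k (ℕₚ.<⇒≤ (ℕₚ.<-≤-trans c<n n≤t))) later)
                         t-now ⟩
        P θ (length D) * K ℚ.+ θ ^ length D * Pfact θ (length D)
          ≡⟨ one-threat-algebra θ j e (length D) (ℕₚ.suc-injective |D|+1≡) ⟩
        θ ^ e * P θ (suc j) * Pfact θ (length D) ∎
        where
        open ≡-Reasoning
        K : ℚ
        K = θ ^ e * P θ j * Pfact θ (length D ∸ 1)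
        i≤k : i ≤ k
        i≤k = m+[1+o]≡1+n⇒m≤n i j i+d≡k+1
        D<t : All (_< t) D
        D<t = All.map (λ c<n → ℕₚ.<-≤-trans c<n n≤t) D<n
        later : ∀ c → mem c D ≡ true → unpicked (length D) (delete c D ++ [ t ]) (c ∷ pre) (suc i) ≡ K
        later c c∈D =
          trans (cong (λ m → unpicked m (delete c D ++ [ t ]) (c ∷ pre) (suc i)) (sym |D∖c|+1≡|D|))
            (trans (unpicked-one-threat j e (c ∷ pre) (suc i) (delete-sorted c D↑) (delete⁺ c D<n)
                      (trans |D∖c|+1≡|D| (ℕₚ.suc-injective |D|+1≡))
                      (trans (sym (ℕₚ.+-suc i j)) i+d≡k+1) (Inv-step pre c inv (mem⇒All D<t c∈D)))
                   (cong (λ m → θ ^ e * P θ j * Pfact θ (m ∸ 1)) |D∖c|+1≡|D|))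
          where
          |D∖c|+1≡|D| : suc (length (delete c D)) ≡ length D
          |D∖c|+1≡|D| = length-delete c D c∈D
        t-now : step (D ++ [ t ]) pre i t * unpicked (length D) (delete t (D ++ [ t ])) (t ∷ pre) (suc i)
                  ≡ θ ^ length D * Pfact θ (length D)
        t-now rewrite step-rejected (D ++ [ t ]) pre i t (quiet pre i t inv i≤k ℕₚ.≤-refl)
                    | delete-last t D (All≢⇒mem≡false (All.map ℕₚ.>⇒≢ D<t)) | countBelow-all< t D<t =
          cong (θ ^ length D *_)
               (unpicked-dominated (length D) (t ∷ pre) (suc i) D↑ refl D<n (t-dominates pre inv))

    -- Values are 0-based: n and suc n are the two largest of the values 0, …, n + 1.
    module TopTwo (n : ℕ) where

      SecondSeen : List ℕ → Set
      SecondSeen pre = mem n pre ≡ true × countAbove (suc n) pre ≡ 0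

      LargestSeen : List ℕ → Set
      LargestSeen pre = mem (suc n) pre ≡ true × countAbove n pre ≡ 1

      Overdue : List ℕ → ℕ → Set
      Overdue pre i = k₁ < i × countAbove n pre ≡ 0

      SecondSeen-quiet : ∀ pre i c → SecondSeen pre → i ≤ k₁ → c ≤ suc n → accepts i pre c ≡ false
      SecondSeen-quiet pre i c _ i≤k₁ _ = rejects-early i pre c i≤k₁

      SecondSeen-step : ∀ pre c → SecondSeen pre → c < suc n → SecondSeen (c ∷ pre)
      SecondSeen-step pre c (n∈pre , ≡0) c<n+1 =
        mem-there n c pre n∈pre , trans (countAbove-∷-≤ pre (ℕₚ.<⇒≤ c<n+1)) ≡0

      SecondSeen-dominated : ∀ pre → SecondSeen pre → Dominated n (suc n ∷ pre)
      SecondSeen-dominated pre (n∈pre , _) = Dominated-∷ {pre = pre} (ℕₚ.n≤1+n n) ℕₚ.≤-refl n∈pre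

      SecondSeen-accepts : ∀ pre i → SecondSeen pre → k₁ < i → accepts i pre (suc n) ≡ true
      SecondSeen-accepts pre i (_ , ≡0) k₁<i = accepts-max i pre (suc n) k₁<i ≡0

      module LargestPending = OneThreat n (suc n) k₁ (ℕₚ.n≤1+n n) SecondSeen
        SecondSeen-quiet SecondSeen-step SecondSeen-dominated SecondSeen-accepts

      LargestSeen-quiet : ∀ pre i c → LargestSeen pre → i ≤ k₂ → c ≤ n → accepts i pre c ≡ false
      LargestSeen-quiet pre i c (n+1∈pre , _) i≤k₂ c≤n =
        rejects-covered i pre c i≤k₂ (ℕₚ.≤-trans (s≤s z≤n) (countAbove-mem pre (s≤s c≤n) n+1∈pre))

      LargestSeen-step : ∀ pre c → LargestSeen pre → c < n → LargestSeen (c ∷ pre)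
      LargestSeen-step pre c (n+1∈pre , ≡1) c<n =
        mem-there (suc n) c pre n+1∈pre , trans (countAbove-∷-≤ pre (ℕₚ.<⇒≤ c<n)) ≡1

      LargestSeen-dominated : ∀ pre → LargestSeen pre → Dominated n (n ∷ pre)
      LargestSeen-dominated pre (n+1∈pre , _) = Dominated-∷ {pre = pre} ℕₚ.≤-refl (ℕₚ.n≤1+n n) n+1∈pre

      LargestSeen-accepts : ∀ pre i → LargestSeen pre → k₂ < i → accepts i pre n ≡ true
      LargestSeen-accepts pre i (_ , ≡1) k₂<i = accepts-second i pre n k₂<i ≡1

      module SecondPending = OneThreat n n k₂ ℕₚ.≤-refl LargestSeen
        LargestSeen-quiet LargestSeen-step LargestSeen-dominated LargestSeen-accepts

      Overdue-accepts : ∀ pre i → Overdue pre i → accepts i pre (suc n) ≡ true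
      Overdue-accepts pre i (k₁<i , ≡0) =
        accepts-max i pre (suc n) k₁<i
          (ℕₚ.n≤0⇒n≡0 (ℕₚ.≤-trans (countAbove-antimono pre (ℕₚ.n≤1+n n)) (ℕₚ.≤-reflexive ≡0)))

      Overdue-step : ∀ pre i c → Overdue pre i → c < suc n →
        accepts i pre c ≡ true ⊎ Overdue (c ∷ pre) (suc i)
      Overdue-step pre i c (k₁<i , ≡0) (s≤s c≤n) with ℕₚ.m≤n⇒m<n∨m≡n c≤n
      ... | inj₁ c<n  = inj₂ (ℕₚ.m<n⇒m<1+n k₁<i , trans (countAbove-∷-≤ pre (ℕₚ.<⇒≤ c<n)) ≡0)
      ... | inj₂ refl = inj₁ (accepts-max i pre n k₁<i ≡0)

      open Doomed (suc n) Overdue Overdue-accepts Overdue-step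

      unpicked-two-threats : ∀ d s e {D} pre i → Sorted D → All (_< n) D →
        suc (suc (length D)) ≡ d + s + e → i + d ≡ suc k₁ → i + d + s ≡ suc k₂ → countAbove n pre ≡ 0 →
        unpicked (suc (suc (length D))) (D ++ n ∷ suc n ∷ []) pre i
          ≡ θ ^ (s + e + e) * P θ d * P θ ((d + s) ∸ 1) * Pfact θ (length D)
      unpicked-two-threats zero s e {D} pre i D↑ D<n _ i+0≡k₁+1 _ ≡0 =
        trans (unpicked-doomed (suc (suc (length D))) pre i
                 (∈⇒mem {suc n} {D ++ n ∷ suc n ∷ []} (∈-++⁺ʳ D (there (here refl))))
                 (++⁺ (All.map (λ c<n → ℕₚ.<⇒≤ (ℕₚ.m<n⇒m<1+n c<n)) D<n) (ℕₚ.n≤1+n n ∷ ℕₚ.≤-refl ∷ []))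
                 (m+0≡1+n⇒n<m i i+0≡k₁+1 , ≡0))
          (sym (solve 3 (λ x y z → x :* con 0ℚ :* y :* z := con 0ℚ) refl
                  (θ ^ (s + e + e)) (P θ (s ∸ 1)) (Pfact θ (length D))))
      unpicked-two-threats (suc d) s e {D} pre i D↑ D<n |D|+2≡ i+d≡k₁+1 i+d+s≡k₂+1 ≡0 = begin
        unpicked (suc (suc q)) (D ++ n ∷ suc n ∷ []) pre i
          ≡⟨ sumℚ-++ _ D (n ∷ suc n ∷ []) ⟩
        _ ≡⟨ cong₂ ℚ._+_
               (sum-smaller-first (suc q) (n ∷ suc n ∷ []) pre i K D↑ D<n (ℕₚ.≤-refl ∷ ℕₚ.n≤1+n n ∷ [])
                  (λ c _ → rejects-early i pre c i≤k₁) later)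
               (cong₂ ℚ._+_ second-now (cong (ℚ._+ 0ℚ) largest-now)) ⟩
        _ ≡⟨ two-threats-algebra θ d s e q (ℕₚ.suc-injective |D|+2≡) ⟩
        θ ^ (s + e + e) * P θ (suc d) * P θ (d + s) * Pfact θ q ∎
        where
        open ≡-Reasoning
        q : ℕ
        q = length D
        K : ℚ
        K = θ ^ (s + e + e) * P θ d * P θ ((d + s) ∸ 1) * Pfact θ (q ∸ 1)
        i≤k₁ : i ≤ k₁
        i≤k₁ = m+[1+o]≡1+n⇒m≤n i d i+d≡k₁+1
        q+1≡d+s+e : suc q ≡ d + s + e
        q+1≡d+s+e = ℕₚ.suc-injective |D|+2≡
        n∉D : mem n D ≡ false
        n∉D = All≢⇒mem≡false (All.map ℕₚ.>⇒≢ D<n)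
        n+1∉D : mem (suc n) D ≡ false
        n+1∉D = All≢⇒mem≡false (All.map (ℕₚ.>⇒≢ ∘ ℕₚ.m<n⇒m<1+n) D<n)

        later : ∀ c → mem c D ≡ true →
          unpicked (suc q) (delete c D ++ n ∷ suc n ∷ []) (c ∷ pre) (suc i) ≡ K
        later c c∈D =
          trans (cong (λ m → unpicked (suc m) (delete c D ++ n ∷ suc n ∷ []) (c ∷ pre) (suc i))
                      (sym |D∖c|+1≡|D|))
            (trans (unpicked-two-threats d s e (c ∷ pre) (suc i) (delete-sorted c D↑) (delete⁺ c D<n)
                      (trans (cong suc |D∖c|+1≡|D|) q+1≡d+s+e)
                      (trans (sym (ℕₚ.+-suc i d)) i+d≡k₁+1)
                      (trans (cong (_+ s) (sym (ℕₚ.+-suc i d))) i+d+s≡k₂+1)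
                      (trans (countAbove-∷-≤ pre (ℕₚ.<⇒≤ (mem⇒All D<n c∈D))) ≡0))
                   (cong (λ m → θ ^ (s + e + e) * P θ d * P θ ((d + s) ∸ 1) * Pfact θ (m ∸ 1))
                         |D∖c|+1≡|D|))
          where
          |D∖c|+1≡|D| : suc (length (delete c D)) ≡ length D
          |D∖c|+1≡|D| = length-delete c D c∈D

        second-now : step (D ++ n ∷ suc n ∷ []) pre i n
                       * unpicked (suc q) (delete n (D ++ n ∷ suc n ∷ [])) (n ∷ pre) (suc i)
                     ≡ θ ^ q * (θ ^ (s + e) * P θ d * Pfact θ q)
        second-now
          rewrite step-rejected (D ++ n ∷ suc n ∷ []) pre i n (rejects-early i pre n i≤k₁)
                | delete-++ʳ n D (n ∷ suc n ∷ []) n∉D | delete-head n (suc n ∷ [])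
                | countBelow-++ n D [ suc n ] | countBelow-all< n D<n
                | ≤⇒<ᵇ≡false {suc n} {n} (ℕₚ.n≤1+n n) | ℕₚ.+-identityʳ q =
          cong (θ ^ q *_)
            (LargestPending.unpicked-one-threat d (s + e) (n ∷ pre) (suc i) D↑ D<n
               (trans q+1≡d+s+e (ℕₚ.+-assoc d s e)) (trans (sym (ℕₚ.+-suc i d)) i+d≡k₁+1)
               (mem-head n pre , trans (countAbove-∷-≤ pre (ℕₚ.n≤1+n n))
                                       (ℕₚ.n≤0⇒n≡0 (ℕₚ.≤-trans (countAbove-antimono pre (ℕₚ.n≤1+n n))
                                                               (ℕₚ.≤-reflexive ≡0)))))

        largest-now : step (D ++ n ∷ suc n ∷ []) pre i (suc n)
                        * unpicked (suc q) (delete (suc n) (D ++ n ∷ suc n ∷ [])) (suc n ∷ pre) (suc i)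
                      ≡ θ ^ suc q * (θ ^ e * P θ (d + s) * Pfact θ q)
        largest-now
          rewrite step-rejected (D ++ n ∷ suc n ∷ []) pre i (suc n) (rejects-early i pre (suc n) i≤k₁)
                | delete-++ʳ (suc n) D (n ∷ suc n ∷ []) n+1∉D
                | ≢⇒≡ᵇ≡false (ℕₚ.>⇒≢ (ℕₚ.n<1+n n)) | delete-head (suc n) []
                | countBelow-++ (suc n) D [ n ] | countBelow-all< (suc n) (All.map ℕₚ.m<n⇒m<1+n D<n)
                | <⇒<ᵇ≡true (ℕₚ.n<1+n n) | ℕₚ.+-comm q 1 =
          cong (θ ^ suc q *_)
            (SecondPending.unpicked-one-threat (d + s) e (suc n ∷ pre) (suc i) D↑ D<n q+1≡d+s+e
               (trans (cong suc (sym (ℕₚ.+-assoc i d s)))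
                      (trans (cong (_+ s) (sym (ℕₚ.+-suc i d))) i+d+s≡k₂+1))
               (mem-head (suc n) pre , trans (countAbove-∷-< pre (ℕₚ.n<1+n n)) (cong suc ≡0)))

  upTo-+2 : ∀ n → upTo (suc (suc n)) ≡ upTo n ++ n ∷ suc n ∷ []
  upTo-+2 n = begin
    upTo (suc (suc n))             ≡⟨ sym (Listₚ.upTo-∷ʳ (suc n)) ⟩
    upTo (suc n) ++ [ suc n ]      ≡⟨ cong (_++ [ suc n ]) (sym (Listₚ.upTo-∷ʳ n)) ⟩
    (upTo n ++ [ n ]) ++ [ suc n ] ≡⟨ Listₚ.++-assoc (upTo n) [ n ] [ suc n ] ⟩
    upTo n ++ n ∷ suc n ∷ []       ∎
    where open ≡-Reasoning

  [a+s+e]+[a+s+e]∸a∸[a+s]≡s+e+e : ∀ a s e → (a + s + e + (a + s + e)) ∸ a ∸ (a + s) ≡ s + e + e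
  [a+s+e]+[a+s+e]∸a∸[a+s]≡s+e+e a s e = begin
    (a + s + e + (a + s + e)) ∸ a ∸ (a + s)
      ≡⟨ cong (λ m → (m + (a + s + e)) ∸ a ∸ (a + s)) (ℕₚ.+-assoc a s e) ⟩
    (a + (s + e) + (a + s + e)) ∸ a ∸ (a + s)
      ≡⟨ cong (λ m → m ∸ a ∸ (a + s)) (ℕₚ.+-assoc a (s + e) (a + s + e)) ⟩
    (a + (s + e + (a + s + e))) ∸ a ∸ (a + s)
      ≡⟨ cong (_∸ (a + s)) (ℕₚ.m+n∸m≡n a (s + e + (a + s + e))) ⟩
    (s + e + (a + s + e)) ∸ (a + s)
      ≡⟨ cong (_∸ (a + s)) (ℕ+.x∙yz≈y∙xz (s + e) (a + s) e) ⟩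
    (a + s + (s + e + e)) ∸ (a + s)
      ≡⟨ ℕₚ.m+n∸m≡n (a + s) (s + e + e) ⟩
    s + e + e ∎
    where open ≡-Reasoning

  T₁-closed-form : ∀ θ N k₁ k₂ → 2 ≤ N → k₁ ≤ k₂ → k₂ ≤ N →
    T₁ θ N k₁ k₂ ≡ θ ^ ((N + N) ∸ k₁ ∸ k₂) * P θ k₁ * P θ (k₂ ∸ 1) * Pfact θ (N ∸ 2)
  T₁-closed-form θ (suc zero) k₁ k₂ (s≤s ()) _ _
  T₁-closed-form θ (suc (suc n)) k₁ k₂ _ k₁≤k₂ k₂≤N
    with s , refl ← ℕₚ.m≤n⇒∃[o]m+o≡n k₁≤k₂ | e , k₁+s+e≡N ← ℕₚ.m≤n⇒∃[o]m+o≡n k₂≤N = begin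
    T₁ θ N k₁ (k₁ + s)
      ≡⟨ T₁≡unpicked N ⟩
    unpicked N (upTo N) [] 1
      ≡⟨ cong₂ (λ m L → unpicked (suc (suc m)) L [] 1) (sym (Listₚ.length-upTo n)) (upTo-+2 n) ⟩
    unpicked (suc (suc (length (upTo n)))) (upTo n ++ n ∷ suc n ∷ []) [] 1
      ≡⟨ unpicked-two-threats k₁ s e [] 1 (upTo-sorted n) (all-upTo n)
           (trans (cong (suc ∘ suc) (Listₚ.length-upTo n)) (sym k₁+s+e≡N)) refl refl refl ⟩
    θ ^ (s + e + e) * P θ k₁ * P θ ((k₁ + s) ∸ 1) * Pfact θ (length (upTo n))
      ≡⟨ cong₂ (λ x m → θ ^ x * P θ k₁ * P θ ((k₁ + s) ∸ 1) * Pfact θ m)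
               (trans (sym ([a+s+e]+[a+s+e]∸a∸[a+s]≡s+e+e k₁ s e))
                      (cong (λ m → (m + m) ∸ k₁ ∸ (k₁ + s)) k₁+s+e≡N))
               (Listₚ.length-upTo n) ⟩
    θ ^ ((N + N) ∸ k₁ ∸ (k₁ + s)) * P θ k₁ * P θ ((k₁ + s) ∸ 1) * Pfact θ n ∎
    where
    open ≡-Reasoning
    open Strategy θ k₁ (k₁ + s)
    open Evaluation θ k₁ (k₁ + s) (ℕₚ.m≤m+n k₁ s)
    open TopTwo n
    N : ℕ
    N = suc (suc n)

open import Data.Nat using (ℕ; _≤_; _∸_; _+_)
open import Data.Rational using (ℚ; 0ℚ; _<_; _*_)
open import Relation.Binary.PropositionalEquality using (_≡_)

lemma10 : (θ : ℚ) → 0ℚ < θ → (N k₁ k₂ : ℕ) → 2 ≤ N → k₁ ≤ k₂ → k₂ ≤ N →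
    T₁ θ N k₁ k₂ ≡ (θ ^ ((N + N) ∸ k₁ ∸ k₂)) * P θ k₁ * P θ (k₂ ∸ 1) * Pfact θ (N ∸ 2)
lemma10 θ _ = T₁-ClosedForm.T₁-closed-form θ
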